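{- Let $\mathcal{M}_1=(X_1,\mathcal{N}_1,V_1)$ and $\mathcal{M}_2=(X_2,\mathcal{N}_2,V_2)$ be quasi-discrete neighbourhood models and $\rho\subseteq X_1\times X_2$. Then $\rho$ is a modal bisimulation if and only if every pair $(x_1,x_2)\in\rho$ satisfies the neighbourhood bisimulation conditions with respect to $\rho$.
   Context: A neighbourhood space $(X,\mathcal{N})$ assigns to each $x\in X$ a filter $\mathcal{N}(x)$ on $X$ (closed under non-empty finite intersections and supersets, $\emptyset\notin\mathcal{N}(x)$) with $x\in N$ for all $N\in\mathcal{N}(x)$. It is quasi-discrete if every $x$ has a minimal neighbourhood $\mathcal{N}_{\min}(x)\in\mathcal{N}(x)$ contained in every member of $\mathcal{N}(x)$. A quasi-discrete neighbourhood model $(X,\mathcal{N},V)$ is a quasi-discrete space with a valuation $V:X\to\mathcal{P}(\mathsf{P})$ (and index space $\mathbb{N}$). Its induced edge relation is $R=\{(x,y)\mid y\in\mathcal{N}_{\min}(x)\}$. A relation $\rho\subseteq X_1\times X_2$ is a modal bisimulation if for every $x_1\rho x_2$: $V_1(x_1)=V_2(x_2)$; if $(x_1,y_1)\in R_1$ then there is $y_2$ with $(x_2,y_2)\in R_2$ and $y_1\rho y_2$; if $(x_2,y_2)\in R_2$ then there is $y_1$ with $(x_1,y_1)\in R_1$ and $y_1\rho y_2$. Neighbourhood bisimulation conditions for a pair $x_1 Z x_2$: (atomic) $V_1(x_1)=V_2(x_2)$; (forth) for every $N_2\in\mathcal{N}_2(x_2)$ there is $N_1\in\mathcal{N}_1(x_1)$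 such that every $y_1\in N_1$ has some $y_2\in N_2$ with $y_1Zy_2$; (back) for every $N_1\in\mathcal{N}_1(x_1)$ there is $N_2\in\mathcal{N}_2(x_2)$ such that every $y_2\in N_2$ has some $y_1\in N_1$ with $y_1Zy_2$. -}

module Defs where

open import Data.Nat using (ℕ)
open import Data.Product using (Σ; ∃; _×_; _,_)
open import Data.Empty using (⊥)
open import Function.Bundles using (_⇔_)

Subset : Set → Set₁
Subset X = X → Set

_⊆_ : {X : Set} → Subset X → Subset X → Set
A ⊆ B = ∀ x → A x → B x

_∩_ : {X : Set} → Subset X → Subset X → Subset X
(A ∩ B) x = A x × B x

∅ : {X : Set} → Subset X
∅ _ = ⊥

record IsFilter {X : Set} (F : Subset X → Set) : Set₁ where
  field
    upward : ∀ {A B} → F A → A ⊆ B → F B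
    inter  : ∀ {A B} → F A → F B → F (A ∩ B)
    no-∅   : F ∅ → ⊥

-- Quasi-discrete neighbourhood model with propositional letters indexed by ℕ.
-- V x p  means  p ∈ V(x).
record QDModel : Set₂ where
  field
    X      : Set
    N      : X → Subset X → Set
    filter : ∀ x → IsFilter (N x)
    point  : ∀ x A → N x A → A x
    V      : X → ℕ → Set
    -- quasi-discreteness: a minimal neighbourhood for each point
    Nmin     : X → Subset X
    Nmin-nbh : ∀ x → N x (Nmin x)
    Nmin-min : ∀ x A → N x A → Nmin x ⊆ A

  R : X → X → Set
  R x y = Nmin x y

open QDModel

Rel : QDModel → QDModel → Set₁
Rel M₁ M₂ = X M₁ → X M₂ → Set

SameVal : (M₁ M₂ : QDModel) → X M₁ → X M₂ → Set
SameVal M₁ M₂ x₁ x₂ = ∀ p → V M₁ x₁ p ⇔ V M₂ x₂ p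

IsModalBisim : (M₁ M₂ : QDModel) → Rel M₁ M₂ → Set
IsModalBisim M₁ M₂ ρ = ∀ x₁ x₂ → ρ x₁ x₂ →
    SameVal M₁ M₂ x₁ x₂
  × (∀ y₁ → R M₁ x₁ y₁ → Σ (X M₂) λ y₂ → R M₂ x₂ y₂ × ρ y₁ y₂)
  × (∀ y₂ → R M₂ x₂ y₂ → Σ (X M₁) λ y₁ → R M₁ x₁ y₁ × ρ y₁ y₂)

NbhBisimConds : (M₁ M₂ : QDModel) → Rel M₁ M₂ → X M₁ → X M₂ → Set₁
NbhBisimConds M₁ M₂ Z x₁ x₂ =
    SameVal M₁ M₂ x₁ x₂
  × (∀ N₂ → N M₂ x₂ N₂ → Σ (Subset (X M₁)) λ N₁ → N M₁ x₁ N₁ ×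
       (∀ y₁ → N₁ y₁ → Σ (X M₂) λ y₂ → N₂ y₂ × Z y₁ y₂))
  × (∀ N₁ → N M₁ x₁ N₁ → Σ (Subset (X M₂)) λ N₂ → N M₂ x₂ N₂ ×
       (∀ y₂ → N₂ y₂ → Σ (X M₁) λ y₁ → N₁ y₁ × Z y₁ y₂))

module Submission where

-- Write "A is S-covered by B" when every element of A is
-- S-related to some element of B.  Both kinds of bisimulation are phrased in
-- terms of coverings:
--   * the modal forth/back clauses at (x₁, x₂) say that the minimal
--     neighbourhood of x₁ is ρ-covered by that of x₂, and conversely
--     (with ρ flipped);
--   * the neighbourhood forth/back clauses say that every neighbourhood of
--     one point covers some neighbourhood of the other.
-- For neighbourhood systems that have a least member the two readings agree
-- (simulates⇔minimalCovers): coverings shrink in their source and grow in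
-- their target (covers-mono), so it suffices to test least neighbourhoods.
-- Applying this twice, once for ρ and once for its converse, shows that the
-- modal clauses and the neighbourhood clauses are equivalent pair by pair
-- (modal⇔nbh), from which lemma25 follows at once.

open import Defs
open import Function.Base using (flip)
open import Function.Bundles using (_⇔_; mk⇔; Equivalence)
open import Data.Product using (_×_; _,_; Σ)
open QDModel

Covers : {A B : Set} → (A → B → Set) → Subset A → Subset B → Set
Covers {B = B} S A′ B′ = ∀ a → A′ a → Σ B λ b → B′ b × S a b

covers-mono : {A B : Set} {S : A → B → Set} {A′ A″ : Subset A} {B′ B″ : Subset B} →
  A″ ⊆ A′ → B′ ⊆ B″ → Covers S A′ B′ → Covers S A″ B″
covers-mono A″⊆A′ B′⊆B″ cov a a∈A″ =
  let (b , b∈B′ , sab) = cov a (A″⊆A′ a a∈A″) in b , B′⊆B″ b b∈B′ , sab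

Simulates : {A B : Set} → (Subset A → Set) → (Subset B → Set) → (A → B → Set) → Set₁
Simulates {A} F G S = ∀ B′ → G B′ → Σ (Subset A) λ A′ → F A′ × Covers S A′ B′

record Least {A : Set} (F : Subset A → Set) : Set₁ where
  field
    least     : Subset A
    least∈    : F least
    least-min : ∀ A′ → F A′ → least ⊆ A′
open Least

nbhLeast : (M : QDModel) (x : X M) → Least (N M x)
nbhLeast M x = record { least = Nmin M x ; least∈ = Nmin-nbh M x ; least-min = Nmin-min M x }

simulates⇔minimalCovers : {A B : Set} {F : Subset A → Set} {G : Subset B → Set}
  {S : A → B → Set} (lF : Least F) (lG : Least G) →
  Simulates F G S ⇔ Covers S (least lF) (least lG)
simulates⇔minimalCovers {S = S} lF lG = mk⇔ toCovers toSimulates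
  where
  toCovers : Simulates _ _ S → Covers S (least lF) (least lG)
  toCovers sim =
    let (A′ , A′∈F , cov) = sim (least lG) (least∈ lG)
    in covers-mono (least-min lF A′ A′∈F) (λ _ b∈ → b∈) cov

  toSimulates : Covers S (least lF) (least lG) → Simulates _ _ S
  toSimulates cov B′ B′∈G =
    least lF , least∈ lF , covers-mono (λ _ a∈ → a∈) (least-min lG B′ B′∈G) cov

module _ (M₁ M₂ : QDModel) (ρ : Rel M₁ M₂) (x₁ : X M₁) (x₂ : X M₂) where

  -- The three clauses of IsModalBisim at (x₁, x₂), read as coverings of
  -- minimal neighbourhoods (R x y is Nmin x y by definition).
  ModalClauses : Set
  ModalClauses = SameVal M₁ M₂ x₁ x₂
    × Covers ρ (Nmin M₁ x₁) (Nmin M₂ x₂)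
    × Covers (flip ρ) (Nmin M₂ x₂) (Nmin M₁ x₁)

  forth⇔ : Simulates (N M₁ x₁) (N M₂ x₂) ρ ⇔ Covers ρ (Nmin M₁ x₁) (Nmin M₂ x₂)
  forth⇔ = simulates⇔minimalCovers (nbhLeast M₁ x₁) (nbhLeast M₂ x₂)

  back⇔ : Simulates (N M₂ x₂) (N M₁ x₁) (flip ρ) ⇔ Covers (flip ρ) (Nmin M₂ x₂) (Nmin M₁ x₁)
  back⇔ = simulates⇔minimalCovers (nbhLeast M₂ x₂) (nbhLeast M₁ x₁)

  modal⇔nbh : ModalClauses ⇔ NbhBisimConds M₁ M₂ ρ x₁ x₂
  modal⇔nbh = mk⇔
    (λ (val , fo , ba) → val , Equivalence.from forth⇔ fo , Equivalence.from back⇔ ba)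
    (λ (val , fo , ba) → val , Equivalence.to forth⇔ fo , Equivalence.to back⇔ ba)

lemma25 : (M₁ M₂ : QDModel) (ρ : Rel M₁ M₂) →
    (IsModalBisim M₁ M₂ ρ →
      ∀ x₁ x₂ → ρ x₁ x₂ → NbhBisimConds M₁ M₂ ρ x₁ x₂)
    × ((∀ x₁ x₂ → ρ x₁ x₂ → NbhBisimConds M₁ M₂ ρ x₁ x₂) →
      IsModalBisim M₁ M₂ ρ)
lemma25 M₁ M₂ ρ =
    (λ modal x₁ x₂ r → Equivalence.to (modal⇔nbh M₁ M₂ ρ x₁ x₂) (modal x₁ x₂ r))
  , (λ nbh x₁ x₂ r → Equivalence.from (modal⇔nbh M₁ M₂ ρ x₁ x₂) (nbh x₁ x₂ r))
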